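{- Let $m\ge1$, $n=2^m-1$, and let $\iota,\kappa\in\dot F^m$ satisfy $d(\iota,0^m)\ge3$, $d(\kappa,0^m)\ge3$ and $d(\iota,\kappa)\ge3$. Then the sets $R_\iota+\hat\iota+\bar e^{(\iota)}$ and $R_\kappa+\hat\kappa+\bar e^{(\kappa)}$ (subsets of $F^n$) are disjoint, and neither of them contains $0^n$.
   Context: $F^m$ denotes the vector space of binary $m$-tuples over $GF(2)$, and $\dot F^m=F^m\setminus\{0^m\}$; $\pi^{(1)},\dots,\pi^{(m)}$ is the standard basis of $F^m$. Let $n=2^m-1$. Elements of $F^n$ are written $\bar w=\{w_\iota\}_{\iota\in\dot F^m}$, i.e. their coordinates are indexed by the nonzero vectors of $F^m$, where the first $m$ coordinates are those indexed by $\pi^{(1)},\dots,\pi^{(m)}$ (in this order) and the remaining $n-m$ coordinates are in some fixed order. $\{\bar e^{(\iota)}\}_{\iota\in\dot F^m}$ is the standard basis of $F^n$. For $\alpha=(\alpha_1,\dots,\alpha_m)\in F^m$, $\hat\alpha=(\alpha,0^{n-m})=\sum_{i=1}^m\alpha_i\bar e^{(\pi^{(i)})}\in F^n$. $d(\cdot,\cdot)$ is the Hamming distance. The Hamming code is $H=\{\bar c\in F^n : \sum_{\alpha\in\dot F^m} c_\alpha\alpha=0^m\}$. For $\iota\in\dot F^m$, the linear $\iota$-component of $H$ is $R_\iota=\{\bar c\in H : c_\alpha=c_{\alpha+\iota}\text{ for all }\alpha\in F^m\setminus\langle\iota\rangle\}$, where $\langle\cdot\rangle$ denotes linear span. -}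

module Defs where

open import Data.Bool using (Bool; true; false; _xor_; _∧_; if_then_else_)
open import Data.Bool.Properties using () renaming (_≟_ to _≟B_)
open import Data.Nat using (ℕ; zero; suc; _+_)
open import Data.Fin using (Fin)
open import Data.Vec using (Vec; []; _∷_; replicate; zipWith; lookup; allFin; toList)
open import Data.Vec.Properties using (≡-dec)
open import Data.List using (List; []; _∷_; _++_; map; foldr; concatMap)
open import Data.Product using (Σ; _×_; _,_)
open import Relation.Binary.PropositionalEquality using (_≡_; _≢_)
open import Relation.Nullary using (¬_)
open import Relation.Nullary.Decidable using (⌊_⌋)

Pt : ℕ → Set
Pt m = Vec Bool m

zeroPt : ∀ {m} → Pt m
zeroPt = replicate _ false

_⊕_ : ∀ {m} → Pt m → Pt m → Pt m
_⊕_ = zipWith _xor_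

_·_ : ∀ {m} → Bool → Pt m → Pt m
b · α = if b then α else zeroPt

wt : ∀ {m} → Pt m → ℕ
wt [] = 0
wt (true ∷ v) = suc (wt v)
wt (false ∷ v) = wt v

dist : ∀ {m} → Pt m → Pt m → ℕ
dist u v = wt (u ⊕ v)

basis : ∀ {m} → Fin m → Pt m
basis {m} i = Data.Vec.tabulate (λ j → ⌊ i Data.Fin.≟ j ⌋)
  where import Data.Vec ; import Data.Fin

allPts : ∀ m → List (Pt m)
allPts zero = [] ∷ []
allPts (suc m) = map (false ∷_) (allPts m) ++ map (true ∷_) (allPts m)

_≟P_ : ∀ {m} (u v : Pt m) → Relation.Nullary.Dec (u ≡ v)
_≟P_ = ≡-dec _≟B_
  where import Relation.Nullary

-- Words of F^n, n = 2^m - 1: coordinates indexed by the nonzero vectors of F^m.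
-- Represented as functions on F^m; the value at 0^m is irrelevant and is
-- ignored by every notion below (equality of words is WEq).
Word : ℕ → Set
Word m = Pt m → Bool

zeroWord : ∀ {m} → Word m
zeroWord _ = false

_+W_ : ∀ {m} → Word m → Word m → Word m
(w +W u) v = w v xor u v

WEq : ∀ {m} → Word m → Word m → Set
WEq {m} w u = (v : Pt m) → v ≢ zeroPt → w v ≡ u v

unit : ∀ {m} → Pt m → Word m
unit ι v = ⌊ v ≟P ι ⌋

hat : ∀ {m} → Pt m → Word m
hat {m} α v = foldr _xor_ false
  (map (λ i → lookup α i ∧ ⌊ v ≟P basis i ⌋) (toList (allFin m)))

-- syndrome Σ_{α ≠ 0} c_α α  (the α = 0 term contributes 0^m anyway)
syndrome : ∀ {m} → Word m → Pt m
syndrome {m} c = foldr _⊕_ zeroPt (map (λ α → c α · α) (allPts m))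

InH : ∀ {m} → Word m → Set
InH c = syndrome c ≡ zeroPt

InR : ∀ {m} → Pt m → Word m → Set
InR {m} ι c = InH c × ((α : Pt m) → α ≢ zeroPt → α ≢ ι → c α ≡ c (α ⊕ ι))

InShifted : ∀ {m} → Pt m → Word m → Set
InShifted ι w = Σ (Word _) λ c → InR ι c × WEq w ((c +W hat ι) +W unit ι)

module Submission where

-- For a word w and a direction ι write Δ ι w α = w α + w (α + ι)
-- for the derivative of w along ι.  Words of R_ι are constant on the pairs
-- {α, α + ι}, so every w in the coset R_ι + ι̂ + e^(ι) has the derivative of ι̂
-- at every α ∉ {0, ι}.  Since ι̂ is supported on the basis vectors π^(i), this
-- derivative is ι_i at α = π^(i) (when wt ι ≥ 3) and 0 at any α with
-- wt α ≥ 2 and wt (α + ι) ≥ 2.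
--   If w lies in both cosets, walking around the square
--   π^(i), π^(i) + ι, π^(i) + ι + κ, π^(i) + κ
-- (whose three non-basis corners have weight ≥ 2 by the distance hypotheses)
-- shows ι_i = κ_i for every i, so ι = κ, contradicting d(ι, κ) ≥ 3.
-- If 0^n lies in the ι-coset, its derivative vanishes, so every ι_i = 0,
-- contradicting wt ι ≥ 3.
--   The file develops, in order: the group F^m, Hamming weight, the basis
-- vectors, XOR-sums and the word ι̂, the derivative of coset words, and the
-- theorem.

open import Defs
open import Function using (_∘_)
open import Data.Nat using (ℕ; zero; suc; _+_; _≤_; z≤n; s≤s; s≤s⁻¹)
open import Data.Nat.Properties using (≤-trans; ≤-reflexive; +-suc; +-monoʳ-≤; n≤1+n; m≤n⇒m≤1+n)
open import Data.Bool using (Bool; true; false; _xor_; _∧_)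
open import Data.Bool.Properties
  using (xor-assoc; xor-comm; xor-same; xor-identityˡ; xor-identityʳ; ∧-zeroʳ; ∧-identityʳ)
open import Data.Fin using (Fin) renaming (zero to fz; suc to fs; _≟_ to _≟F_)
open import Data.Fin.Properties using (suc-injective)
open import Data.Vec using ([]; _∷_; tabulate; lookup; toList)
open import Data.Vec.Properties
  using (zipWith-assoc; zipWith-comm; zipWith-identityˡ; tabulate-cong; tabulate∘lookup;
         lookup∘tabulate; lookup-replicate)
open import Data.List using (map; foldr)
open import Data.Product using (_×_; _,_)
open import Relation.Nullary using (¬_; Dec; yes; no; contradiction)
open import Relation.Nullary.Decidable using (⌊_⌋; isYes≗does; dec-true; dec-false)
open import Relation.Binary.PropositionalEquality

private
  variable
    m k : ℕ
    A : Set

⌊⌋-true : (a? : Dec A) → A → ⌊ a? ⌋ ≡ true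
⌊⌋-true a? a = trans (isYes≗does a?) (dec-true a? a)

⌊⌋-false : (a? : Dec A) → ¬ A → ⌊ a? ⌋ ≡ false
⌊⌋-false a? ¬a = trans (isYes≗does a?) (dec-false a? ¬a)

⊕-assoc : (x y z : Pt m) → (x ⊕ y) ⊕ z ≡ x ⊕ (y ⊕ z)
⊕-assoc = zipWith-assoc xor-assoc

⊕-comm : (x y : Pt m) → x ⊕ y ≡ y ⊕ x
⊕-comm = zipWith-comm xor-comm

⊕-identityˡ : (x : Pt m) → zeroPt ⊕ x ≡ x
⊕-identityˡ = zipWith-identityˡ xor-identityˡ

⊕-self : (x : Pt m) → x ⊕ x ≡ zeroPt
⊕-self []      = refl
⊕-self (a ∷ x) = cong₂ _∷_ (xor-same a) (⊕-self x)

⊕-cancelʳ : (x y z : Pt m) → x ⊕ z ≡ y ⊕ z → x ≡ y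
⊕-cancelʳ x y z e = begin
  x              ≡⟨ remove x ⟩
  (x ⊕ z) ⊕ z    ≡⟨ cong (_⊕ z) e ⟩
  (y ⊕ z) ⊕ z    ≡⟨ remove y ⟨
  y              ∎
  where
  open ≡-Reasoning
  remove : (u : Pt _) → u ≡ (u ⊕ z) ⊕ z
  remove u = sym (trans (⊕-assoc u z z) (trans (cong (u ⊕_) (⊕-self z))
                   (trans (⊕-comm u zeroPt) (⊕-identityˡ u))))

⊕≡zero⇒≡ : (x y : Pt m) → x ⊕ y ≡ zeroPt → x ≡ y
⊕≡zero⇒≡ x y e = ⊕-cancelʳ x y y (trans e (sym (⊕-self y)))

⊕≡right⇒zero : (x y : Pt m) → x ⊕ y ≡ y → x ≡ zeroPt
⊕≡right⇒zero x y e = ⊕-cancelʳ x zeroPt y (trans e (sym (⊕-identityˡ y)))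

⊕-swapʳ : (x y z : Pt m) → (x ⊕ y) ⊕ z ≡ (x ⊕ z) ⊕ y
⊕-swapʳ x y z = trans (⊕-assoc x y z) (trans (cong (x ⊕_) (⊕-comm y z)) (sym (⊕-assoc x z y)))

lookup-ext : (x y : Pt m) → (∀ i → lookup x i ≡ lookup y i) → x ≡ y
lookup-ext x y h = trans (sym (tabulate∘lookup x)) (trans (tabulate-cong h) (tabulate∘lookup y))

wt-zero : ∀ m → wt (zeroPt {m}) ≡ 0
wt-zero zero    = refl
wt-zero (suc m) = wt-zero m

wt-triangle : (u v : Pt m) → wt v ≤ wt u + wt (u ⊕ v)
wt-triangle []          []          = z≤n
wt-triangle (false ∷ u) (false ∷ v) = wt-triangle u v
wt-triangle (false ∷ u) (true ∷ v)  =
  ≤-trans (s≤s (wt-triangle u v)) (≤-reflexive (sym (+-suc (wt u) _)))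
wt-triangle (true ∷ u)  (false ∷ v) =
  m≤n⇒m≤1+n (≤-trans (wt-triangle u v) (+-monoʳ-≤ (wt u) (n≤1+n _)))
wt-triangle (true ∷ u)  (true ∷ v)  = s≤s (wt-triangle u v)

wt-pos⇒≢zero : (x : Pt m) → suc k ≤ wt x → x ≢ zeroPt
wt-pos⇒≢zero {m} {k} x h refl = contradiction (subst (suc k ≤_) (wt-zero m) h) λ ()

basis-zero : basis {suc m} fz ≡ true ∷ zeroPt
basis-zero {m} = cong (true ∷_) (all-false m)
  where
  all-false : ∀ m → tabulate {n = m} (λ _ → false) ≡ zeroPt
  all-false zero    = refl
  all-false (suc m) = cong (false ∷_) (all-false m)

basis-suc : (i : Fin m) → basis (fs i) ≡ false ∷ basis i
basis-suc i = cong (false ∷_) (tabulate-cong (same-test i))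
  where
  same-test : (i j : Fin m) → ⌊ fs i ≟F fs j ⌋ ≡ ⌊ i ≟F j ⌋
  same-test i j with i ≟F j
  ... | yes _ = refl
  ... | no  _ = refl

wt-basis : (i : Fin m) → wt (basis i) ≡ 1
wt-basis {suc m} fz     = trans (cong wt (basis-zero {m})) (cong suc (wt-zero m))
wt-basis {suc m} (fs i) = trans (cong wt (basis-suc i)) (wt-basis i)

basis-injective : (i j : Fin m) → basis i ≡ basis j → i ≡ j
basis-injective i j e with i ≟F j
... | yes i≡j = i≡j
... | no  i≢j = contradiction (begin
  false                ≡⟨ ⌊⌋-false (i ≟F j) i≢j ⟨
  ⌊ i ≟F j ⌋           ≡⟨ lookup∘tabulate _ j ⟨
  lookup (basis i) j   ≡⟨ cong (λ v → lookup v j) e ⟩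
  lookup (basis j) j   ≡⟨ lookup∘tabulate _ j ⟩
  ⌊ j ≟F j ⌋           ≡⟨ ⌊⌋-true (j ≟F j) refl ⟩
  true                 ∎) λ ()
  where open ≡-Reasoning

wt≥2⇒≢basis : (x : Pt m) → 2 ≤ wt x → (i : Fin m) → x ≢ basis i
wt≥2⇒≢basis x h i refl = contradiction (subst (2 ≤_) (wt-basis i) h) λ { (s≤s ()) }

wt-basis-⊕ : (i : Fin m) (v : Pt m) → suc k ≤ wt v → k ≤ wt (basis i ⊕ v)
wt-basis-⊕ i v h =
  s≤s⁻¹ (≤-trans h (subst (λ n → wt v ≤ n + wt (basis i ⊕ v)) (wt-basis i) (wt-triangle (basis i) v)))

xorSum : ∀ k → (Fin k → Bool) → Bool
xorSum zero    f = false
xorSum (suc k) f = f fz xor xorSum k (f ∘ fs)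

foldr-xor-tabulate : (h : Fin m → Bool) (g : Fin k → Fin m) →
                     foldr _xor_ false (map h (toList (tabulate g))) ≡ xorSum k (h ∘ g)
foldr-xor-tabulate {k = zero}  h g = refl
foldr-xor-tabulate {k = suc k} h g = cong (h (g fz) xor_) (foldr-xor-tabulate h (g ∘ fs))

xorSum-zero : (f : Fin k → Bool) → (∀ j → f j ≡ false) → xorSum k f ≡ false
xorSum-zero {zero}  f z = refl
xorSum-zero {suc k} f z rewrite z fz = xorSum-zero (f ∘ fs) (z ∘ fs)

xorSum-single : (f : Fin k → Bool) (i : Fin k) → (∀ j → j ≢ i → f j ≡ false) → xorSum k f ≡ f i
xorSum-single {suc k} f fz z =
  trans (cong (f fz xor_) (xorSum-zero (f ∘ fs) λ j → z (fs j) λ ())) (xor-identityʳ (f fz))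
xorSum-single {suc k} f (fs i) z rewrite z fz (λ ()) =
  xorSum-single (f ∘ fs) i λ j j≢i → z (fs j) (j≢i ∘ suc-injective)

hat-as-xorSum : (α v : Pt m) → hat α v ≡ xorSum m (λ i → lookup α i ∧ ⌊ v ≟P basis i ⌋)
hat-as-xorSum α v = foldr-xor-tabulate (λ i → lookup α i ∧ ⌊ v ≟P basis i ⌋) (λ i → i)

hat-basis : (α : Pt m) (i : Fin m) → hat α (basis i) ≡ lookup α i
hat-basis α i = begin
  hat α (basis i)                                   ≡⟨ hat-as-xorSum α (basis i) ⟩
  xorSum _ term                                     ≡⟨ xorSum-single term i off-i ⟩
  lookup α i ∧ ⌊ basis i ≟P basis i ⌋               ≡⟨ cong (lookup α i ∧_) (⌊⌋-true (basis i ≟P basis i) refl) ⟩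
  lookup α i ∧ true                                 ≡⟨ ∧-identityʳ _ ⟩
  lookup α i                                        ∎
  where
  open ≡-Reasoning
  term : Fin _ → Bool
  term j = lookup α j ∧ ⌊ basis i ≟P basis j ⌋
  off-i : ∀ j → j ≢ i → term j ≡ false
  off-i j j≢i = trans (cong (lookup α j ∧_) (⌊⌋-false (basis i ≟P basis j)
                  (j≢i ∘ sym ∘ basis-injective i j))) (∧-zeroʳ _)

hat-off-basis : (α v : Pt m) → (∀ j → v ≢ basis j) → hat α v ≡ false
hat-off-basis α v nb = trans (hat-as-xorSum α v) (xorSum-zero _ λ j →
  trans (cong (lookup α j ∧_) (⌊⌋-false (v ≟P basis j) (nb j))) (∧-zeroʳ _))

Δ : Pt m → Word m → Pt m → Bool
Δ ι w α = w α xor w (α ⊕ ι)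

Δ≡false⇒≡ : (ι : Pt m) (w : Word m) (α : Pt m) → Δ ι w α ≡ false → w α ≡ w (α ⊕ ι)
Δ≡false⇒≡ ι w α = lemma (w α) (w (α ⊕ ι))
  where
  lemma : ∀ a b → a xor b ≡ false → a ≡ b
  lemma false false _ = refl
  lemma true  true  _ = refl

-- On a coset word the R_ι-part drops out of the derivative away from ⟨ι⟩.
Δ-coset : (ι : Pt m) (w : Word m) → InShifted ι w →
          (α : Pt m) → α ≢ zeroPt → α ≢ ι → Δ ι w α ≡ Δ ι (hat ι) α
Δ-coset ι w (c , (_ , c-const) , w≈) α α≢0 α≢ι
  rewrite w≈ α α≢0 | w≈ (α ⊕ ι) (α≢ι ∘ ⊕≡zero⇒≡ α ι) | c-const α α≢0 α≢ι
        | ⌊⌋-false (α ≟P ι) α≢ι | ⌊⌋-false ((α ⊕ ι) ≟P ι) (α≢0 ∘ ⊕≡right⇒zero α ι)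
  = cancel (c (α ⊕ ι)) (hat ι α) (hat ι (α ⊕ ι))
  where
  cancel : ∀ x h h′ → ((x xor h) xor false) xor ((x xor h′) xor false) ≡ h xor h′
  cancel false false false = refl
  cancel false false true  = refl
  cancel false true  false = refl
  cancel false true  true  = refl
  cancel true  false false = refl
  cancel true  false true  = refl
  cancel true  true  false = refl
  cancel true  true  true  = refl

Δ-basis : (ι : Pt m) (w : Word m) → 3 ≤ wt ι → InShifted ι w →
          (i : Fin m) → Δ ι w (basis i) ≡ lookup ι i
Δ-basis ι w h s i = begin
  Δ ι w (basis i)                          ≡⟨ Δ-coset ι w s (basis i) basis≢0 basis≢ι ⟩
  hat ι (basis i) xor hat ι (basis i ⊕ ι)  ≡⟨ cong₂ _xor_ (hat-basis ι i)
                                                (hat-off-basis ι _ (wt≥2⇒≢basis _ (wt-basis-⊕ i ι h))) ⟩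
  lookup ι i xor false                     ≡⟨ xor-identityʳ _ ⟩
  lookup ι i                               ∎
  where
  open ≡-Reasoning
  basis≢0 : basis i ≢ zeroPt
  basis≢0 = wt-pos⇒≢zero (basis i) (≤-reflexive (sym (wt-basis i)))
  basis≢ι : basis i ≢ ι
  basis≢ι e = wt≥2⇒≢basis ι (≤-trans (n≤1+n 2) h) i (sym e)

Δ-off-basis : (ι : Pt m) (w : Word m) → InShifted ι w →
              (α : Pt m) → 2 ≤ wt α → 2 ≤ wt (α ⊕ ι) → Δ ι w α ≡ false
Δ-off-basis ι w s α hα hαι = begin
  Δ ι w α                    ≡⟨ Δ-coset ι w s α (wt-pos⇒≢zero α hα) α≢ι ⟩
  hat ι α xor hat ι (α ⊕ ι)  ≡⟨ cong₂ _xor_ (hat-off-basis ι α (wt≥2⇒≢basis α hα))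
                                          (hat-off-basis ι (α ⊕ ι) (wt≥2⇒≢basis (α ⊕ ι) hαι)) ⟩
  false                      ∎
  where
  open ≡-Reasoning
  α≢ι : α ≢ ι
  α≢ι refl = wt-pos⇒≢zero (α ⊕ α) hαι (⊕-self α)

-- The square π^(i), π^(i) + ι, π^(i) + ι + κ, π^(i) + κ: a word in both cosets
-- forces ι and κ to agree in every coordinate.
coset-coordinates : (ι κ : Pt m) (w : Word m) → 3 ≤ wt ι → 3 ≤ wt κ → 3 ≤ dist ι κ →
                    InShifted ι w → InShifted κ w → (i : Fin m) → lookup ι i ≡ lookup κ i
coset-coordinates ι κ w hι hκ hικ sι sκ i = begin
  lookup ι i               ≡⟨ Δ-basis ι w hι sι i ⟨
  w p xor w (p ⊕ ι)        ≡⟨ cong (w p xor_) (Δ≡false⇒≡ κ w (p ⊕ ι) (Δ-off-basis κ w sκ (p ⊕ ι) wt-pι wt-pικ)) ⟩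
  w p xor w ((p ⊕ ι) ⊕ κ)  ≡⟨ cong (λ x → w p xor w x) (⊕-swapʳ p ι κ) ⟩
  w p xor w ((p ⊕ κ) ⊕ ι)  ≡⟨ cong (w p xor_) (Δ≡false⇒≡ ι w (p ⊕ κ) (Δ-off-basis ι w sι (p ⊕ κ) wt-pκ wt-pκι)) ⟨
  w p xor w (p ⊕ κ)        ≡⟨ Δ-basis κ w hκ sκ i ⟩
  lookup κ i               ∎
  where
  open ≡-Reasoning
  p : Pt _
  p = basis i
  wt-pι : 2 ≤ wt (p ⊕ ι)
  wt-pι = wt-basis-⊕ i ι hι
  wt-pκ : 2 ≤ wt (p ⊕ κ)
  wt-pκ = wt-basis-⊕ i κ hκ
  wt-pικ : 2 ≤ wt ((p ⊕ ι) ⊕ κ)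
  wt-pικ = subst (λ x → 2 ≤ wt x) (sym (⊕-assoc p ι κ)) (wt-basis-⊕ i (ι ⊕ κ) hικ)
  wt-pκι : 2 ≤ wt ((p ⊕ κ) ⊕ ι)
  wt-pκι = subst (λ x → 2 ≤ wt x) (⊕-swapʳ p ι κ) wt-pικ

cosets-disjoint : (ι κ : Pt m) → 3 ≤ wt ι → 3 ≤ wt κ → 3 ≤ dist ι κ →
                  (w : Word m) → InShifted ι w → ¬ InShifted κ w
cosets-disjoint ι κ hι hκ hικ w sι sκ =
  wt-pos⇒≢zero (ι ⊕ κ) hικ (trans (cong (ι ⊕_) (sym ι≡κ)) (⊕-self ι))
  where
  ι≡κ : ι ≡ κ
  ι≡κ = lookup-ext ι κ (coset-coordinates ι κ w hι hκ hικ sι sκ)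

-- The zero word has zero derivative, so it would force ι = 0.
zero∉coset : (ι : Pt m) → 3 ≤ wt ι → ¬ InShifted ι zeroWord
zero∉coset ι h s = wt-pos⇒≢zero ι h (lookup-ext ι zeroPt λ i →
  trans (sym (Δ-basis ι zeroWord h s i)) (sym (lookup-replicate i false)))

lemma3 : (m : ℕ) → 1 ≤ m → (ι κ : Pt m) →
         3 ≤ wt ι → 3 ≤ wt κ → 3 ≤ dist ι κ →
         ((w : Word m) → InShifted ι w → ¬ InShifted κ w)
         × ¬ InShifted ι zeroWord × ¬ InShifted κ zeroWord
lemma3 m _ ι κ hι hκ hικ =
  cosets-disjoint ι κ hι hκ hικ , zero∉coset ι hι , zero∉coset κ hκ
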